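{- Let $G$ and $H$ be finite simple connected graphs, each with at least two vertices, and suppose $\Delta(H)\le n(H)-2$. If $o(G\circ H)=\mathcal{R}$, then $R_{\rm MB}(G\circ H)\ge n(G)\,{\rm lc}(H)$.
   Context: $n(X)$ is the number of vertices of a graph $X$ and $\Delta(X)$ its maximum degree. The lexicographic product $G\circ H$ has vertex set $V(G)\times V(H)$, with $(g,h)(g',h')$ an edge iff $gg'\in E(G)$, or $g=g'$ and $hh'\in E(H)$. A set $W\subseteq V(X)$ is a resolving set of a connected graph $X$ if for every two distinct vertices $x,y$ there is $z\in W$ with $d(x,z)\ne d(y,z)$ (shortest-path distance). In the Maker-Breaker resolving game on $X$, two players, Resolver and Spoiler, alternately select unplayed vertices of $X$; Resolver wins if the set of vertices he selects contains a resolving set of $X$, and Spoiler wins if she selects at least one vertex of every resolving set of $X$. The R-game is the game where Resolver moves first; the S-game is the game where Spoiler moves first. The outcome $o(X)$ is $\mathcal{R}$ if Resolver has a winning strategy no matter who starts, $\mathcal{S}$ if Spoiler has a winning strategy no matter who starts, and $\mathcal{N}$ if the first player has a winning strategy. $R_{\rm MB}(X)$ is the minimum number of moves Resolver needs to win the R-game on $X$ when both players play optimally. A set $S\subseteq V(H)$ is a locating set of $H$ if $N_H(u)\cap S\ne N_H(v)\cap S$ for every two distinct vertices $u,v\in V(H)\setminus S$, where $N_H(u)$ is the open neighborhood; ${\rm lc}(H)$ is the minimum size of a locating set of $H$. -}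

module Defs where

open import Data.Nat using (ℕ; zero; suc; _≤_; _<_; _*_; _∸_)
open import Data.Fin using (Fin; remQuot; _≟_)
open import Data.Fin.Subset using (Subset; _∈_; _∉_; _∩_; _∪_; ⁅_⁆; ∣_∣)
open import Data.Bool using (Bool; true; false; _∧_; _∨_)
open import Data.Vec using (tabulate)
open import Data.Product using (Σ; ∃; _×_; _,_)
open import Relation.Binary.PropositionalEquality using (_≡_; _≢_)
open import Relation.Nullary using (¬_)
open import Relation.Nullary.Decidable using (⌊_⌋)

record Graph : Set where
  constructor mkGraph
  field
    n   : ℕ
    adj : Fin n → Fin n → Bool
open Graph public

IsSimple : Graph → Set
IsSimple X = (∀ x y → adj X x y ≡ adj X y x) × (∀ x → adj X x x ≡ false)

data Walk (X : Graph) : Fin (n X) → Fin (n X) → ℕ → Set where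
  here : ∀ {x} → Walk X x x 0
  step : ∀ {x y z k} → adj X x y ≡ true → Walk X y z k → Walk X x z (suc k)

Connected : Graph → Set
Connected X = ∀ x y → ∃ λ k → Walk X x y k

Dist : (X : Graph) → Fin (n X) → Fin (n X) → ℕ → Set
Dist X x y k = Walk X x y k × (∀ m → m < k → ¬ Walk X x y m)

N[_] : (X : Graph) → Fin (n X) → Subset (n X)
N[ X ] u = tabulate (adj X u)

degree : (X : Graph) → Fin (n X) → ℕ
degree X u = ∣ N[ X ] u ∣

MaxDegree≤ : Graph → ℕ → Set
MaxDegree≤ X b = ∀ u → degree X u ≤ b

_∘ₗ_ : Graph → Graph → Graph
G ∘ₗ H = mkGraph (n G * n H) adjL
  where
  adjL : Fin (n G * n H) → Fin (n G * n H) → Bool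
  adjL p q with remQuot (n H) p | remQuot (n H) q
  ... | g , h | g' , h' = adj G g g' ∨ (⌊ g ≟ g' ⌋ ∧ adj H h h')

Resolving : (X : Graph) → Subset (n X) → Set
Resolving X W = ∀ x y → x ≢ y →
  Σ (Fin (n X)) λ z → z ∈ W × Σ ℕ λ a → Σ ℕ λ b → Dist X x z a × Dist X y z b × a ≢ b

Locating : (H : Graph) → Subset (n H) → Set
Locating H S = ∀ u v → u ≢ v → u ∉ S → v ∉ S → ¬ (N[ H ] u ∩ S ≡ N[ H ] v ∩ S)

IsLc : Graph → ℕ → Set
IsLc H l = (Σ (Subset (n H)) λ S → Locating H S × ∣ S ∣ ≡ l)
         × (∀ S → Locating H S → l ≤ ∣ S ∣)

-- Maker–Breaker resolving game.  r = Resolver's vertices, s = Spoiler's.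
-- RTurn X r s k : Resolver to move, he can force a win making at most k more moves.
-- STurn X r s k : Spoiler to move, Resolver can force a win making at most k more moves.
mutual
  data RTurn (X : Graph) (r s : Subset (n X)) : ℕ → Set where
    rdone : ∀ {k} → Resolving X r → RTurn X r s k
    rmove : ∀ {k} v → v ∉ r → v ∉ s → STurn X (r ∪ ⁅ v ⁆) s k → RTurn X r s (suc k)

  data STurn (X : Graph) (r s : Subset (n X)) : ℕ → Set where
    sdone : ∀ {k} → Resolving X r → STurn X r s k
    sall  : ∀ {k} → (Σ (Fin (n X)) λ v → v ∉ r × v ∉ s)
          → (∀ v → v ∉ r → v ∉ s → RTurn X r (s ∪ ⁅ v ⁆) k) → STurn X r s k

open import Data.Fin.Subset using (⊥)

ResolverWinsRGame : Graph → Set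
ResolverWinsRGame X = ∃ λ k → RTurn X ⊥ ⊥ k

ResolverWinsSGame : Graph → Set
ResolverWinsSGame X = ∃ λ k → STurn X ⊥ ⊥ k

OutcomeR : Graph → Set
OutcomeR X = ResolverWinsRGame X × ResolverWinsSGame X

IsRMB : Graph → ℕ → Set
IsRMB X k = RTurn X ⊥ ⊥ k × (∀ k' → RTurn X ⊥ ⊥ k' → k ≤ k')

{-# OPTIONS --safe #-}
-- Let W be a resolving set of G ∘ H and g a vertex of G. Two vertices (g,u), (g,v) of the
-- layer {g} × V(H) are at the same distance from every vertex outside the layer, since a
-- shortest path leaves the layer along an edge of G, and every vertex of the layer sees that
-- edge. Inside the layer distances are 1 or 2 according to adjacency in H, because g has a
-- neighbour in G. Hence the H-coordinates of W ∩ ({g} × V(H)) locate H, and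
-- ∣W∣ ≥ n(G) lc(H). A Resolver strategy winning the R-game in k moves ends with a resolving
-- set of at most k vertices.
module Submission where

open import Defs
open import Data.Nat using (ℕ; suc; _≤_; _<_; _*_; _+_; _∸_; z≤n; s≤s)
open import Data.Nat.Properties
  using (≤-refl; ≤-trans; ≤-antisym; ≮⇒≥; m≤m+n; m≤n⇒m≤1+n; n≤1+n; +-suc; +-assoc; +-mono-≤; +-monoˡ-≤; +-monoʳ-≤; module ≤-Reasoning)
open import Data.Fin using (Fin; zero; suc; remQuot; combine; _≟_)
open import Data.Fin.Properties using (remQuot-combine; combine-remQuot; combine-injectiveʳ)
open import Data.Fin.Subset using (Subset; _∈_; _∩_; _∪_; ⁅_⁆; ∣_∣; ⊥)
open import Data.Fin.Subset.Properties using (∣⊥∣≡0; ∣⁅x⁆∣≡1)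
open import Data.Bool using (Bool; true; false; _∧_; _∨_)
open import Data.Bool.Properties using (∧-identityʳ; ∨-identityʳ)
open import Data.Vec using (Vec; []; _∷_; tabulate; lookup; _++_; concat; group)
open import Data.Vec.Properties using ([]=⇒lookup; lookup⇒[]=; lookup-zipWith; lookup∘tabulate; tabulate∘lookup; tabulate-cong; lookup-concat)
open import Data.Product using (∃; _×_; _,_; proj₁; proj₂)
open import Data.Empty using (⊥-elim)
open import Function using (_∘_)
open import Relation.Binary.PropositionalEquality using (_≡_; _≢_; refl; sym; trans; cong; cong₂; subst; module ≡-Reasoning)
open import Relation.Nullary using (yes; no)
open import Relation.Nullary.Decidable using (⌊_⌋; isYes≗does; dec-true; dec-false)

∣p++q∣≡∣p∣+∣q∣ : ∀ {a b} (p : Subset a) (q : Subset b) → ∣ p ++ q ∣ ≡ ∣ p ∣ + ∣ q ∣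
∣p++q∣≡∣p∣+∣q∣ []          q = refl
∣p++q∣≡∣p∣+∣q∣ (true ∷ p)  q = cong suc (∣p++q∣≡∣p∣+∣q∣ p q)
∣p++q∣≡∣p∣+∣q∣ (false ∷ p) q = ∣p++q∣≡∣p∣+∣q∣ p q

∣p∪q∣≤∣p∣+∣q∣ : ∀ {m} (p q : Subset m) → ∣ p ∪ q ∣ ≤ ∣ p ∣ + ∣ q ∣
∣p∪q∣≤∣p∣+∣q∣ []          []          = z≤n
∣p∪q∣≤∣p∣+∣q∣ (true ∷ p)  (true ∷ q)  = s≤s (≤-trans (∣p∪q∣≤∣p∣+∣q∣ p q) (+-monoʳ-≤ ∣ p ∣ (n≤1+n ∣ q ∣)))
∣p∪q∣≤∣p∣+∣q∣ (true ∷ p)  (false ∷ q) = s≤s (∣p∪q∣≤∣p∣+∣q∣ p q)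
∣p∪q∣≤∣p∣+∣q∣ (false ∷ p) (true ∷ q)  = subst (∣ p ∪ q ∣ <_) (sym (+-suc ∣ p ∣ ∣ q ∣)) (s≤s (∣p∪q∣≤∣p∣+∣q∣ p q))
∣p∪q∣≤∣p∣+∣q∣ (false ∷ p) (false ∷ q) = ∣p∪q∣≤∣p∣+∣q∣ p q

-- fibre W g = { h ∣ (g , h) ∈ W }, the vertex (g , h) of G ∘ₗ H being combine g h.
fibre : ∀ {m k} → Subset (m * k) → Fin m → Subset k
fibre W g = tabulate (λ h → lookup W (combine g h))

combine∈⇒∈fibre : ∀ {m k} {W : Subset (m * k)} {g h} → combine g h ∈ W → h ∈ fibre {m} W g
combine∈⇒∈fibre {W = W} {g} {h} gh∈W =
  lookup⇒[]= h _ (trans (lookup∘tabulate _ h) ([]=⇒lookup gh∈W))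

fibre-concat : ∀ {m k} (xss : Vec (Subset k) m) g → fibre {m} (concat xss) g ≡ lookup xss g
fibre-concat xss g = trans (tabulate-cong (lookup-concat xss g)) (tabulate∘lookup (lookup xss g))

l≤∣lookup∣⇒m*l≤∣concat∣ : ∀ {m k l} (xss : Vec (Subset k) m) →
  (∀ g → l ≤ ∣ lookup xss g ∣) → m * l ≤ ∣ concat xss ∣
l≤∣lookup∣⇒m*l≤∣concat∣ []         _ = z≤n
l≤∣lookup∣⇒m*l≤∣concat∣ (xs ∷ xss) l≤ =
  subst (_ ≤_) (sym (∣p++q∣≡∣p∣+∣q∣ xs (concat xss)))
    (+-mono-≤ (l≤ zero) (l≤∣lookup∣⇒m*l≤∣concat∣ xss (l≤ ∘ suc)))

l≤∣fibre∣⇒m*l≤∣W∣ : ∀ {m k l} (W : Subset (m * k)) → (∀ g → l ≤ ∣ fibre {m} W g ∣) → m * l ≤ ∣ W ∣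
l≤∣fibre∣⇒m*l≤∣W∣ {m} {k} W l≤ with group m k W
... | xss , refl = l≤∣lookup∣⇒m*l≤∣concat∣ xss (λ g → subst (λ S → _ ≤ ∣ S ∣) (fibre-concat xss g) (l≤ g))

mutual
  RTurn⇒resolving : ∀ {X r s k} → RTurn X r s k → ∃ λ W → Resolving X W × ∣ W ∣ ≤ ∣ r ∣ + k
  RTurn⇒resolving {r = r} {k = k} (rdone resolving) = r , resolving , m≤m+n ∣ r ∣ k
  RTurn⇒resolving {r = r} (rmove {k = k} v _ _ next) with STurn⇒resolving next
  ... | W , resolving , ∣W∣≤ = W , resolving , (begin
    ∣ W ∣                  ≤⟨ ∣W∣≤ ⟩
    ∣ r ∪ ⁅ v ⁆ ∣ + k      ≤⟨ +-monoˡ-≤ k (∣p∪q∣≤∣p∣+∣q∣ r ⁅ v ⁆) ⟩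
    ∣ r ∣ + ∣ ⁅ v ⁆ ∣ + k  ≡⟨ cong (λ t → ∣ r ∣ + t + k) (∣⁅x⁆∣≡1 v) ⟩
    ∣ r ∣ + 1 + k          ≡⟨ +-assoc ∣ r ∣ 1 k ⟩
    ∣ r ∣ + suc k          ∎)
    where open ≤-Reasoning

  STurn⇒resolving : ∀ {X r s k} → STurn X r s k → ∃ λ W → Resolving X W × ∣ W ∣ ≤ ∣ r ∣ + k
  STurn⇒resolving {r = r} {k = k} (sdone resolving) = r , resolving , m≤m+n ∣ r ∣ k
  STurn⇒resolving (sall (v , v∉r , v∉s) reply) = RTurn⇒resolving (reply v v∉r v∉s)

RTurn⇒resolving≤ : ∀ {X k} → RTurn X ⊥ ⊥ k → ∃ λ W → Resolving X W × ∣ W ∣ ≤ k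
RTurn⇒resolving≤ {X} {k} winning with RTurn⇒resolving winning
... | W , resolving , ∣W∣≤ = W , resolving , subst (λ c → ∣ W ∣ ≤ c + k) (∣⊥∣≡0 (n X)) ∣W∣≤

sameTrace⇒sameAdj : ∀ {X S u v w} → N[ X ] u ∩ S ≡ N[ X ] v ∩ S → w ∈ S → adj X u w ≡ adj X v w
sameTrace⇒sameAdj {X} {S} {u} {v} {w} sameTrace w∈S =
  trans (sym (trace u)) (trans (cong (λ T → lookup T w) sameTrace) (trace v))
  where
  trace : ∀ t → lookup (N[ X ] t ∩ S) w ≡ adj X t w
  trace t = trans (lookup-zipWith _∧_ w (N[ X ] t) S)
              (trans (cong₂ _∧_ (lookup∘tabulate (adj X t) w) ([]=⇒lookup w∈S)) (∧-identityʳ _))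

Walk-firstEdge : ∀ {X x y k} → Walk X x y k → x ≢ y → ∃ λ z → adj X x z ≡ true
Walk-firstEdge here             x≢y = ⊥-elim (x≢y refl)
Walk-firstEdge (step {y = z} e _) _ = z , e

∃neighbour : ∀ {X} → Connected X → 2 ≤ n X → ∀ x → ∃ λ y → adj X x y ≡ true
∃neighbour connected (s≤s (s≤s _)) zero    = Walk-firstEdge (proj₂ (connected zero (suc zero))) λ ()
∃neighbour connected (s≤s (s≤s _)) (suc x) = Walk-firstEdge (proj₂ (connected (suc x) zero)) λ ()

Dist-minimal : ∀ {X x y a j} → Dist X x y a → Walk X x y j → a ≤ j
Dist-minimal (_ , shortest) w = ≮⇒≥ (λ j<a → shortest _ j<a w)

shortDistance : Bool → ℕ
shortDistance true  = 1
shortDistance false = 2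

Dist≡shortDistance : ∀ {X x y a} → Dist X x y a → x ≢ y → Walk X x y 2 → a ≡ shortDistance (adj X x y)
Dist≡shortDistance (here , _) x≢y _ = ⊥-elim (x≢y refl)
Dist≡shortDistance (step e here , _) _ _ rewrite e = refl
Dist≡shortDistance {X} {x} {y} d@(step _ (step _ _) , shortest) _ w₂ with adj X x y in e
... | true  = ⊥-elim (shortest 1 (s≤s (s≤s z≤n)) (step e here))
... | false = ≤-antisym (Dist-minimal d w₂) (s≤s (s≤s z≤n))

module Lexicographic (G H : Graph) where

  coordG : Fin (n (G ∘ₗ H)) → Fin (n G)
  coordG p = proj₁ (remQuot {n G} (n H) p)

  coordH : Fin (n (G ∘ₗ H)) → Fin (n H)
  coordH p = proj₂ (remQuot {n G} (n H) p)

  coordG-combine : ∀ g h → coordG (combine g h) ≡ g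
  coordG-combine g h = cong proj₁ (remQuot-combine g h)

  adj-combine : ∀ g h g' h' →
    adj (G ∘ₗ H) (combine g h) (combine g' h') ≡ adj G g g' ∨ (⌊ g ≟ g' ⌋ ∧ adj H h h')
  adj-combine g h g' h' = cong₂ adjPairs (remQuot-combine g h) (remQuot-combine g' h')
    where
    adjPairs : Fin (n G) × Fin (n H) → Fin (n G) × Fin (n H) → Bool
    adjPairs (g , h) (g' , h') = adj G g g' ∨ (⌊ g ≟ g' ⌋ ∧ adj H h h')

  adj-leavingLayer : ∀ {p q} → coordG p ≢ coordG q → adj (G ∘ₗ H) p q ≡ true →
    adj G (coordG p) (coordG q) ≡ true
  adj-leavingLayer {p} {q} p≢q e = trans (sym (∨-identityʳ _))
    (trans (cong (λ b → adj G (coordG p) (coordG q) ∨ (b ∧ adj H (coordH p) (coordH q)))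
      (sym (trans (isYes≗does (coordG p ≟ coordG q)) (dec-false (coordG p ≟ coordG q) p≢q)))) e)

  adj-fromLayer : ∀ {g h q} → adj G g (coordG q) ≡ true → adj (G ∘ₗ H) (combine g h) q ≡ true
  adj-fromLayer {g} {h} e rewrite coordG-combine g h = cong (_∨ _) e

  walk-leavingLayer : ∀ {p z j} g h → coordG p ≡ g → coordG z ≢ g → Walk (G ∘ₗ H) p z j →
    ∃ λ j' → j' ≤ j × Walk (G ∘ₗ H) (combine g h) z j'
  walk-leavingLayer g h p∈g z∉g here = ⊥-elim (z∉g p∈g)
  walk-leavingLayer g h p∈g z∉g (step {y = q} e w) with coordG q ≟ g
  ... | yes q∈g = let j' , j'≤ , w' = walk-leavingLayer g h q∈g z∉g w in j' , m≤n⇒m≤1+n j'≤ , w'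
  ... | no q∉g  = _ , ≤-refl , step (adj-fromLayer (subst (λ g' → adj G g' (coordG q) ≡ true) p∈g
                                       (adj-leavingLayer (λ p≡q → q∉g (trans (sym p≡q) p∈g)) e))) w

  dist-outsideLayer-≤ : ∀ {g u v z a b} → coordG z ≢ g →
    Dist (G ∘ₗ H) (combine g u) z a → Dist (G ∘ₗ H) (combine g v) z b → a ≤ b
  dist-outsideLayer-≤ {g} {u} {v} z∉g du (wv , _) =
    let j , j≤b , wu = walk-leavingLayer g u (coordG-combine g v) z∉g wv in ≤-trans (Dist-minimal du wu) j≤b

  dist-outsideLayer : ∀ {g u v z a b} → coordG z ≢ g →
    Dist (G ∘ₗ H) (combine g u) z a → Dist (G ∘ₗ H) (combine g v) z b → a ≡ b
  dist-outsideLayer z∉g du dv = ≤-antisym (dist-outsideLayer-≤ z∉g du dv) (dist-outsideLayer-≤ z∉g dv du)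

  module _ (simple : IsSimple G) (connected : Connected G) (2≤nG : 2 ≤ n G) where

    adj-withinLayer : ∀ g u w → adj (G ∘ₗ H) (combine g u) (combine g w) ≡ adj H u w
    adj-withinLayer g u w = begin
      adj (G ∘ₗ H) (combine g u) (combine g w) ≡⟨ adj-combine g u g w ⟩
      adj G g g ∨ (⌊ g ≟ g ⌋ ∧ adj H u w)       ≡⟨ cong₂ (λ a b → a ∨ (b ∧ adj H u w)) (proj₂ simple g)
                                                     (trans (isYes≗does (g ≟ g)) (dec-true (g ≟ g) refl)) ⟩
      adj H u w                                 ∎
      where open ≡-Reasoning

    walk₂-withinLayer : ∀ g u w → Walk (G ∘ₗ H) (combine g u) (combine g w) 2
    walk₂-withinLayer g u w =
      step {y = combine g₁ u} (liftEdge g₁g) (step (liftEdge (trans (proj₁ simple g₁ g) g₁g)) here)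
      where
      g₁  = proj₁ (∃neighbour connected 2≤nG g)
      g₁g = proj₂ (∃neighbour connected 2≤nG g)
      liftEdge : ∀ {g g' h h'} → adj G g g' ≡ true → adj (G ∘ₗ H) (combine g h) (combine g' h') ≡ true
      liftEdge {g} {g'} {h} {h'} e = trans (adj-combine g h g' h') (cong (_∨ _) e)

    dist-withinLayer : ∀ {g u w a} → u ≢ w →
      Dist (G ∘ₗ H) (combine g u) (combine g w) a → a ≡ shortDistance (adj H u w)
    dist-withinLayer {g} {u} {w} u≢w d =
      trans (Dist≡shortDistance d (u≢w ∘ combine-injectiveʳ g u g w) (walk₂-withinLayer g u w))
            (cong shortDistance (adj-withinLayer g u w))

    resolving⇒fibre-locating : ∀ {W} → Resolving (G ∘ₗ H) W → ∀ g → Locating H (fibre {n G} W g)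
    resolving⇒fibre-locating {W} resolving g u v u≢v u∉S v∉S sameTrace
      with resolving (combine g u) (combine g v) (u≢v ∘ combine-injectiveʳ g u g v)
    ... | z , z∈W , a , b , du , dv , a≢b =
      a≢b (sameDistance (coordG z) (coordH z) (sym (combine-remQuot {n G} (n H) z)) z∈W du dv)
      where
      sameDistance : ∀ {z a b} g' w → z ≡ combine g' w → z ∈ W →
        Dist (G ∘ₗ H) (combine g u) z a → Dist (G ∘ₗ H) (combine g v) z b → a ≡ b
      sameDistance g' w refl z∈W du dv with g' ≟ g
      ... | no g'≢g  = dist-outsideLayer (g'≢g ∘ trans (sym (coordG-combine g' w))) du dv
      ... | yes refl = begin
        _                            ≡⟨ dist-withinLayer (λ { refl → u∉S w∈S }) du ⟩
        shortDistance (adj H u w)    ≡⟨ cong shortDistance (sameTrace⇒sameAdj {H} sameTrace w∈S) ⟩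
        shortDistance (adj H v w)    ≡⟨ sym (dist-withinLayer (λ { refl → v∉S w∈S }) dv) ⟩
        _                            ∎
        where
        open ≡-Reasoning
        w∈S : w ∈ fibre {n G} W g
        w∈S = combine∈⇒∈fibre {n G} z∈W

    n*lc≤∣resolving∣ : ∀ {l W} → IsLc H l → Resolving (G ∘ₗ H) W → n G * l ≤ ∣ W ∣
    n*lc≤∣resolving∣ {W = W} (_ , lc-minimal) resolving =
      l≤∣fibre∣⇒m*l≤∣W∣ W (λ g → lc-minimal _ (resolving⇒fibre-locating resolving g))

corollary3p1 : (G H : Graph)
    → IsSimple G → Connected G → 2 ≤ n G
    → IsSimple H → Connected H → 2 ≤ n H
    → MaxDegree≤ H (n H ∸ 2)
    → OutcomeR (G ∘ₗ H)
    → ∀ l → IsLc H l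
    → ∀ k → IsRMB (G ∘ₗ H) k
    → n G * l ≤ k
corollary3p1 G H simple connected 2≤nG _ _ _ _ _ l lc k (winning , _) =
  let W , resolving , ∣W∣≤k = RTurn⇒resolving≤ winning
  in  ≤-trans (Lexicographic.n*lc≤∣resolving∣ G H simple connected 2≤nG lc resolving) ∣W∣≤k
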